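{- The connective $\mathcal R$ is not definable in terms of $\bigcirc$ and $\mathcal U$, even over the class of persistent models: there is no formula $\varphi\in\mathcal L_{\mathcal U}$ such that $q\,\mathcal R\,p\leftrightarrow\varphi$ is valid over the class of persistent models (with $p,q$ distinct propositional variables).
   Context: Formulas of $\mathcal L$ are generated by $\varphi::=p\mid\bot\mid\varphi\wedge\varphi\mid\varphi\vee\varphi\mid\varphi\to\varphi\mid\bigcirc\varphi\mid\Diamond\varphi\mid\Box\varphi\mid\varphi\,\mathcal U\,\varphi\mid\varphi\,\mathcal R\,\varphi$ over a countable set of propositional variables; $\varphi\leftrightarrow\psi:=(\varphi\to\psi)\wedge(\psi\to\varphi)$. $\mathcal L_{\mathcal U}$ is the fragment built from variables, $\bot,\wedge,\vee,\to,\bigcirc,\mathcal U$ only. A dynamic poset is $(W,\preccurlyeq,S)$ with $W\ne\emptyset$, $\preccurlyeq$ a partial order, $S:W\to W$ with $w\preccurlyeq v\Rightarrow S(w)\preccurlyeq S(v)$ (forward confluence). It is persistent if moreover $S$ is backward confluent: whenever $v\succcurlyeq S(w)$ there is $u\succcurlyeq w$ with $S(u)=v$. A model is a dynamic poset with a valuation $V$ assigning to each world a set of variables, monotone along $\preccurlyeq$; a persistent model is one on a persistent dynamic poset. Satisfaction: $w\models p$ iff $p\in V(w)$; $w\not\models\bot$; $\wedge,\vee$ classical; $w\models\varphi\to\psi$ iff for all $v\succcurlyeq w$, $v\models\varphi$ implies $v\models\psi$; $w\models\bigcirc\varphi$ iff $S(w)\models\varphi$; $w\models\Diamond\varphi$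 iff $\exists k\ge0$, $S^k(w)\models\varphi$; $w\models\Box\varphi$ iff $\forall k\ge0$, $S^k(w)\models\varphi$; $w\models\varphi\,\mathcal U\,\psi$ iff $\exists k\ge0$ with $S^k(w)\models\psi$ and $S^i(w)\models\varphi$ for all $i\in[0,k)$; $w\models\varphi\,\mathcal R\,\psi$ iff for all $k\ge0$, $S^k(w)\models\psi$ or $S^i(w)\models\varphi$ for some $i\in[0,k)$. Valid over a class means true at every world of every model in the class. -}

module Defs where

open import Data.Nat using (ℕ; zero; suc; _<_; _≤_)
open import Data.Product using (Σ; _×_; _,_; ∃)
open import Data.Sum using (_⊎_)
open import Data.Empty using (⊥)
open import Data.Unit using (⊤)
open import Relation.Binary.PropositionalEquality using (_≡_)
open import Relation.Binary.Structures using (IsPartialOrder)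

Var : Set
Var = ℕ

data Formula : Set where
  var  : Var → Formula
  ⊥'   : Formula
  _∧'_ : Formula → Formula → Formula
  _∨'_ : Formula → Formula → Formula
  _⇒_  : Formula → Formula → Formula
  ◯_   : Formula → Formula
  ◇_   : Formula → Formula
  □_   : Formula → Formula
  _𝓤_  : Formula → Formula → Formula
  _𝓡_  : Formula → Formula → Formula

infixr 4 _⇒_
infixr 5 _∨'_
infixr 6 _∧'_

_⇔_ : Formula → Formula → Formula
φ ⇔ ψ = (φ ⇒ ψ) ∧' (ψ ⇒ φ)

data InLU : Formula → Set where
  var  : ∀ x → InLU (var x)
  ⊥'   : InLU ⊥'
  _∧'_ : ∀ {φ ψ} → InLU φ → InLU ψ → InLU (φ ∧' ψ)
  _∨'_ : ∀ {φ ψ} → InLU φ → InLU ψ → InLU (φ ∨' ψ)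
  _⇒_  : ∀ {φ ψ} → InLU φ → InLU ψ → InLU (φ ⇒ ψ)
  ◯_   : ∀ {φ} → InLU φ → InLU (◯ φ)
  _𝓤_  : ∀ {φ ψ} → InLU φ → InLU ψ → InLU (φ 𝓤 ψ)

iter : {W : Set} → (W → W) → ℕ → W → W
iter S zero    w = w
iter S (suc k) w = S (iter S k w)

record DynamicPoset : Set₁ where
  field
    W        : Set
    _≼_      : W → W → Set
    isPO     : IsPartialOrder _≡_ _≼_
    S        : W → W
    forward  : ∀ {w v} → w ≼ v → S w ≼ S v

Persistent : DynamicPoset → Set
Persistent D = ∀ w v → S w ≼ v → ∃ λ u → (w ≼ u) × (S u ≡ v)
  where open DynamicPoset D

record Model : Set₁ where
  field
    frame    : DynamicPoset
  open DynamicPoset frame public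
  field
    V        : W → Var → Set
    V-mono   : ∀ {w v x} → w ≼ v → V w x → V v x

PersistentModel : Model → Set
PersistentModel M = Persistent (Model.frame M)

module _ (M : Model) where
  open Model M

  _⊨_ : W → Formula → Set
  w ⊨ var x   = V w x
  w ⊨ ⊥'      = ⊥
  w ⊨ (φ ∧' ψ) = (w ⊨ φ) × (w ⊨ ψ)
  w ⊨ (φ ∨' ψ) = (w ⊨ φ) ⊎ (w ⊨ ψ)
  w ⊨ (φ ⇒ ψ) = ∀ v → w ≼ v → v ⊨ φ → v ⊨ ψ
  w ⊨ (◯ φ)   = S w ⊨ φ
  w ⊨ (◇ φ)   = ∃ λ k → iter S k w ⊨ φ
  w ⊨ (□ φ)   = ∀ k → iter S k w ⊨ φ
  w ⊨ (φ 𝓤 ψ) = ∃ λ k → (iter S k w ⊨ ψ) × (∀ i → i < k → iter S i w ⊨ φ)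
  w ⊨ (φ 𝓡 ψ) = ∀ k → (iter S k w ⊨ ψ) ⊎ (∃ λ i → (i < k) × (iter S i w ⊨ φ))

ValidPersistent : Formula → Set₁
ValidPersistent φ = (M : Model) → PersistentModel M → (w : Model.W M) → _⊨_ M w φ

module Submission where

-- Take the persistent dynamic poset ℕ∞ = {0 ≤ 1 ≤ 2 ≤ … ≤ ∞} with the
-- predecessor map S (0 ↦ 0, n+1 ↦ n, ∞ ↦ ∞), and let the variable p be true
-- exactly at the worlds ≥ 1 (every other variable nowhere).
--   * Along every finite world S eventually reaches 0, where p fails, while q
--     never holds; so q 𝓡 p fails at every finite world, yet it holds at ∞.
--   * Every 𝓛_𝓤-formula is "dichotomous" on this model: either true nowhere or
--     true on a whole final segment [n, ∞].  This is proved by induction on the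
--     formula from closure properties of dichotomous predicates; ∞ being the top
--     world is what makes implication preserve the dichotomy, and 𝓤 only needs
--     its second argument to be dichotomous.
-- A formula true nowhere disagrees with q 𝓡 p at ∞; one true on [n, ∞]
-- disagrees with it at the finite world n.  Hence no equivalence is valid.

open import Defs
open import Data.Nat using (ℕ)
open import Relation.Binary.PropositionalEquality using (_≡_)
open import Relation.Nullary using (¬_)

open import Data.Nat as ℕ using (zero; suc; pred; _∸_; _⊔_; _<_; z≤n; s≤s)
open import Data.Nat.Properties as ℕ using ()
open import Data.Product using (Σ; _×_; _,_; proj₁; proj₂)
open import Data.Sum using (_⊎_; inj₁; inj₂)
open import Data.Empty using (⊥; ⊥-elim)
open import Relation.Binary.PropositionalEquality
  using (refl; sym; cong; isEquivalence)
open import Relation.Nullary using (yes; no)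

data ℕ∞ : Set where
  fin : ℕ → ℕ∞
  ∞   : ℕ∞

infix 4 _≼_

data _≼_ : ℕ∞ → ℕ∞ → Set where
  fin≤ : ∀ {m n} → m ℕ.≤ n → fin m ≼ fin n
  ≤∞   : ∀ {x} → x ≼ ∞

≼-refl : ∀ {x} → x ≼ x
≼-refl {fin n} = fin≤ ℕ.≤-refl
≼-refl {∞}     = ≤∞

≼-trans : ∀ {x y z} → x ≼ y → y ≼ z → x ≼ z
≼-trans (fin≤ m≤n) (fin≤ n≤k) = fin≤ (ℕ.≤-trans m≤n n≤k)
≼-trans _          ≤∞         = ≤∞

≼-antisym : ∀ {x y} → x ≼ y → y ≼ x → x ≡ y
≼-antisym (fin≤ m≤n) (fin≤ n≤m) = cong fin (ℕ.≤-antisym m≤n n≤m)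
≼-antisym ≤∞         ≤∞         = refl

step : ℕ∞ → ℕ∞
step (fin n) = fin (pred n)
step ∞       = ∞

step-mono : ∀ {x y} → x ≼ y → step x ≼ step y
step-mono (fin≤ m≤n) = fin≤ (ℕ.pred-mono-≤ m≤n)
step-mono ≤∞         = ≤∞

ℕ∞-frame : DynamicPoset
ℕ∞-frame = record
  { W       = ℕ∞
  ; _≼_     = _≼_
  ; isPO    = record
    { isPreorder = record
      { isEquivalence = isEquivalence
      ; reflexive     = λ { refl → ≼-refl }
      ; trans         = ≼-trans
      }
    ; antisym = ≼-antisym
    }
  ; S       = step
  ; forward = step-mono
  }

ℕ∞-persistent : Persistent ℕ∞-frame
ℕ∞-persistent w       ∞       _          = ∞ , ≤∞ , refl
ℕ∞-persistent (fin n) (fin m) (fin≤ n-1≤m) = fin (suc m) , fin≤ (≤-suc-of-pred n n-1≤m) , refl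
  where
  ≤-suc-of-pred : ∀ n → pred n ℕ.≤ m → n ℕ.≤ suc m
  ≤-suc-of-pred zero    _ = z≤n
  ≤-suc-of-pred (suc n) le = s≤s le

iter-∞ : ∀ k → iter step k ∞ ≡ ∞
iter-∞ zero    = refl
iter-∞ (suc k) = cong step (iter-∞ k)

iter-fin : ∀ k n → iter step k (fin n) ≡ fin (n ∸ k)
iter-fin zero    n = refl
iter-fin (suc k) n rewrite iter-fin k n = cong fin (ℕ.pred[m∸n]≡m∸[1+n] n k)

iter-fin-self : ∀ n → iter step n (fin n) ≡ fin 0
iter-fin-self n rewrite iter-fin n n = cong fin (ℕ.n∸n≡0 n)

Nowhere : (ℕ∞ → Set) → Set
Nowhere P = ∀ t → ¬ P t

Eventually : (ℕ∞ → Set) → Set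
Eventually P = Σ ℕ λ n → ∀ t → fin n ≼ t → P t

Dichotomous : (ℕ∞ → Set) → Set
Dichotomous P = Nowhere P ⊎ Eventually P

module _ {P Q : ℕ∞ → Set} where

  dichotomous-× : Dichotomous P → Dichotomous Q → Dichotomous (λ t → P t × Q t)
  dichotomous-× (inj₁ noP)     _              = inj₁ λ t pq → noP t (proj₁ pq)
  dichotomous-× (inj₂ _)       (inj₁ noQ)     = inj₁ λ t pq → noQ t (proj₂ pq)
  dichotomous-× (inj₂ (n , f)) (inj₂ (m , g)) = inj₂ (n ⊔ m , λ t n⊔m≼t →
    f t (≼-trans (fin≤ (ℕ.m≤m⊔n n m)) n⊔m≼t) , g t (≼-trans (fin≤ (ℕ.m≤n⊔m n m)) n⊔m≼t))

  dichotomous-⊎ : Dichotomous P → Dichotomous Q → Dichotomous (λ t → P t ⊎ Q t)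
  dichotomous-⊎ (inj₂ (n , f)) _              = inj₂ (n , λ t le → inj₁ (f t le))
  dichotomous-⊎ (inj₁ _)       (inj₂ (m , g)) = inj₂ (m , λ t le → inj₂ (g t le))
  dichotomous-⊎ (inj₁ noP)     (inj₁ noQ)     =
    inj₁ λ { t (inj₁ p) → noP t p ; t (inj₂ q) → noQ t q }

  -- Intuitionistic implication; the case "P eventually, Q nowhere" is refuted
  -- at the top world ∞, which lies above every world and in every final segment.
  dichotomous-⇒ : Dichotomous P → Dichotomous Q →
                  Dichotomous (λ t → ∀ v → t ≼ v → P v → Q v)
  dichotomous-⇒ (inj₁ noP)     _              = inj₂ (0 , λ t _ v _ p → ⊥-elim (noP v p))
  dichotomous-⇒ (inj₂ _)       (inj₂ (m , g)) = inj₂ (m , λ t m≼t v t≼v _ → g v (≼-trans m≼t t≼v))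
  dichotomous-⇒ (inj₂ (n , f)) (inj₁ noQ)     = inj₁ λ t imp → noQ ∞ (imp ∞ ≤∞ (f ∞ ≤∞))

  -- Until is decided by its second argument: it fails wherever Q is nowhere,
  -- and holds (with witness 0) wherever Q holds.
  dichotomous-𝓤 : Dichotomous Q → Dichotomous (λ t →
    Σ ℕ λ k → Q (iter step k t) × (∀ i → i < k → P (iter step i t)))
  dichotomous-𝓤 (inj₁ noQ)     = inj₁ λ { t (k , q , _) → noQ _ q }
  dichotomous-𝓤 (inj₂ (m , g)) = inj₂ (m , λ t le → 0 , g t le , λ i ())

-- ◯ preserves dichotomy: the final segment [n + 1, ∞] is mapped into [n, ∞].
dichotomous-◯ : ∀ {P} → Dichotomous P → Dichotomous (λ t → P (step t))
dichotomous-◯ (inj₁ noP)     = inj₁ λ t → noP (step t)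
dichotomous-◯ (inj₂ (n , f)) = inj₂ (suc n , λ t le → f (step t) (step-segment le))
  where
  step-segment : ∀ {t} → fin (suc n) ≼ t → fin n ≼ step t
  step-segment (fin≤ (s≤s n≤m)) = fin≤ n≤m
  step-segment ≤∞               = ≤∞

module Countdown (p : Var) where

  countdown : Model
  countdown = record
    { frame  = ℕ∞-frame
    ; V      = λ w x → (x ≡ p) × (fin 1 ≼ w)
    ; V-mono = λ { w≼v (x≡p , 1≼w) → x≡p , ≼-trans 1≼w w≼v }
    }

  infix 4 _⊩_

  _⊩_ : ℕ∞ → Formula → Set
  w ⊩ φ = _⊨_ countdown w φ

  𝓛𝓤-dichotomous : ∀ φ → InLU φ → Dichotomous (_⊩ φ)
  𝓛𝓤-dichotomous (var x) (var .x) with x ℕ.≟ p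
  ... | yes x≡p = inj₂ (1 , λ t 1≼t → x≡p , 1≼t)
  ... | no  x≢p = inj₁ λ t v → x≢p (proj₁ v)
  𝓛𝓤-dichotomous ⊥'       ⊥'       = inj₁ λ t ()
  𝓛𝓤-dichotomous (φ ∧' ψ) (a ∧' b) = dichotomous-× (𝓛𝓤-dichotomous φ a) (𝓛𝓤-dichotomous ψ b)
  𝓛𝓤-dichotomous (φ ∨' ψ) (a ∨' b) = dichotomous-⊎ (𝓛𝓤-dichotomous φ a) (𝓛𝓤-dichotomous ψ b)
  𝓛𝓤-dichotomous (φ ⇒ ψ)  (a ⇒ b)  = dichotomous-⇒ (𝓛𝓤-dichotomous φ a) (𝓛𝓤-dichotomous ψ b)
  𝓛𝓤-dichotomous (◯ φ)    (◯ a)    = dichotomous-◯ (𝓛𝓤-dichotomous φ a)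
  𝓛𝓤-dichotomous (φ 𝓤 ψ)  (a 𝓤 b)  = dichotomous-𝓤 {P = _⊩ φ} (𝓛𝓤-dichotomous ψ b)

  release-at-∞ : ∀ q → ∞ ⊩ var q 𝓡 var p
  release-at-∞ q k rewrite iter-∞ k = inj₁ (refl , ≤∞)

  -- From the finite world n, p fails after n steps and q (≠ p) never holds,
  -- so q 𝓡 p fails.
  release-fails-at-fin : ∀ q → ¬ (q ≡ p) → ∀ n → ¬ (fin n ⊩ var q 𝓡 var p)
  release-fails-at-fin q q≢p n release with release n
  ... | inj₂ (_ , _ , q≡p , _) = q≢p q≡p
  ... | inj₁ (_ , 1≼now) rewrite iter-fin-self n with 1≼now
  ...   | fin≤ ()

open Countdown

mainTheorem2 : (p q : ℕ) → ¬ (p ≡ q) → (φ : Formula) → InLU φ →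
    ¬ ValidPersistent ((var q 𝓡 var p) ⇔ φ)
mainTheorem2 p q p≢q φ φ∈𝓛𝓤 valid = refute (𝓛𝓤-dichotomous p φ φ∈𝓛𝓤)
  where
  equivalence-at : ∀ w → _⊩_ p w ((var q 𝓡 var p) ⇔ φ)
  equivalence-at = valid (countdown p) ℕ∞-persistent

  refute : Dichotomous (λ w → _⊩_ p w φ) → ⊥
  refute (inj₁ φ-nowhere) =
    φ-nowhere ∞ (proj₁ (equivalence-at ∞) ∞ ≤∞ (release-at-∞ p q))
  refute (inj₂ (n , φ-from-n)) =
    release-fails-at-fin p q (λ q≡p → p≢q (sym q≡p)) n
      (proj₂ (equivalence-at (fin n)) (fin n) ≼-refl (φ-from-n (fin n) ≼-refl))
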